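{- For $f:[n]^d\to\{0,1\}$: if $\widetilde{I}_f>9\sqrt d$, then $\widetilde{I}_f^->\sqrt d$.
   Context: $n$ is a power of $2$, $\log$ is base $2$. Intervals in $\mathbb{Z}_n$ wrap around. $\mathcal{U}_1(\mathbf{x})$: pick a uniform random coordinate $r\in[d]$, $q_r$ uniform in $\{1,\dots,\log n\}$, a uniform random interval $I_r$ of $\mathbb{Z}_n$ of size $2^{q_r}$ containing $\mathbf{x}_r$, $c_r$ uniform in $I_r\setminus\{\mathbf{x}_r\}$; output $\mathbf{y}$ equal to $\mathbf{x}$ except that $\mathbf{y}_r=c_r$ if $c_r>\mathbf{x}_r$. Define $\widetilde{I}_f=\mathbb{E}_{\mathbf{x}}[d\cdot\Pr_{\mathbf{y}\sim\mathcal{U}_1(\mathbf{x})}[f(\mathbf{x})\ne f(\mathbf{y})]]$ and $\widetilde{I}_f^-=\mathbb{E}_{\mathbf{x}}[d\cdot\Pr_{\mathbf{y}\sim\mathcal{U}_1(\mathbf{x})}[f(\mathbf{x})>f(\mathbf{y})]]$, with $\mathbf{x}$ uniform in $[n]^d$. -}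

module Defs where

open import Data.Bool using (Bool; true; false; if_then_else_)
open import Data.Nat as ℕ using (ℕ; zero; suc; _^_; _∸_; _<ᵇ_; _≡ᵇ_)
open import Data.Nat.Properties using (m^n≢0)
open import Data.Nat.DivMod using (_mod_)
open import Data.Fin using (Fin; toℕ)
open import Data.Vec using (Vec; []; _∷_; lookup; _[_]≔_)
open import Data.List using (List; []; _∷_; map; concatMap; allFin; upTo; filterᵇ; length; applyUpTo)
open import Data.Integer using (+_)
open import Data.Rational using (ℚ; 0ℚ; 1ℚ; _+_; _*_; _/_; _<_; _≤_)

sumQ : ∀ {A : Set} → List A → (A → ℚ) → ℚ
sumQ []       g = 0ℚ
sumQ (a ∷ as) g = g a + sumQ as g

-- expectation under the uniform distribution on the (multi)set listed by xs
-- (only ever applied to nonempty lists below; 0 on the empty list)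
avg : ∀ {A : Set} → List A → (A → ℚ) → ℚ
avg []       g = 0ℚ
avg (a ∷ as) g = sumQ (a ∷ as) g * ((+ 1) / suc (length as))

𝟙 : Bool → ℚ
𝟙 true  = 1ℚ
𝟙 false = 0ℚ

-- n = 2 ^ (suc k), so log n = suc k ≥ 1 ; [n] is modelled as Fin n = {0,…,n-1}
N : ℕ → ℕ
N k = 2 ^ suc k

allVecs : ∀ n d → List (Vec (Fin n) d)
allVecs n zero    = [] ∷ []
allVecs n (suc d) = concatMap (λ a → map (a ∷_) (allVecs n d)) (allFin n)

modN : ∀ k → ℕ → Fin (N k)
modN k m = _mod_ m (N k) {{m^n≢0 2 (suc k)}}

-- E_{y ~ U_1(x)} [ P (f x) (f y) ] / d-free form:
-- r uniform in [d]; q uniform in {1,…,log n}; the interval I_r of size 2^q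
-- containing x_r is {s, s+1, …, s+2^q-1} (mod n) with start s = x_r - j, j uniform
-- in {0,…,2^q-1} (these are exactly the intervals of size 2^q containing x_r);
-- c_r = s + t (mod n) with t uniform in {0,…,2^q-1} \ {j}, i.e. uniform in I_r \ {x_r};
-- y = x with y_r := c_r if c_r > x_r.
probU1 : ∀ k d → (Bool → Bool → Bool) → (Vec (Fin (N k)) d → Bool) → Vec (Fin (N k)) d → ℚ
probU1 k d P f x =
  avg (allFin d) λ r →
  avg (applyUpTo suc (suc k)) λ q →
  avg (upTo (2 ^ q)) λ j →
  avg (filterᵇ (λ t → Data.Bool.not (t ≡ᵇ j)) (upTo (2 ^ q))) λ t →
    let xr = lookup x r
        c  = modN k ((toℕ xr ℕ.+ N k ∸ j) ℕ.+ t)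
        y  = if toℕ xr <ᵇ toℕ c then x [ r ]≔ c else x
    in 𝟙 (P (f x) (f y))
  where import Data.Bool

neqB : Bool → Bool → Bool
neqB true  false = true
neqB false true  = true
neqB _     _     = false

gtB : Bool → Bool → Bool
gtB true false = true
gtB _    _     = false

fromℕ : ℕ → ℚ
fromℕ m = (+ m) / 1

Itilde : ∀ k d → (Vec (Fin (N k)) d → Bool) → ℚ
Itilde k d f = avg (allVecs (N k) d) λ x → fromℕ d * probU1 k d neqB f x

Itilde⁻ : ∀ k d → (Vec (Fin (N k)) d → Bool) → ℚ
Itilde⁻ k d f = avg (allVecs (N k) d) λ x → fromℕ d * probU1 k d gtB f x

-- "v > c · √d" for v : ℚ, expressed without reals:  v ≥ 0  and  c² · d < v²
_>_√_ : ℚ → ℕ → ℕ → Set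
v > c √ d = (0ℚ ≤ v) Data.Product.× (fromℕ (c ℕ.* c ℕ.* d) < v * v)
  where import Data.Product

-- Since f is Boolean, 1[f x ≠ f y] = 2·1[f x > f y] + (f y − f x), so Ĩ_f = 2 Ĩ⁻_f + D with
-- D = d·E[f(y) − f(x)].  For fixed (r, q, j, t) the step of U₁ replaces x_r by σ(x_r) for a
-- rotation σ of ℤ_n, but only when this increases x_r.  Reindexing the sum over x by the bijection σ
-- gives E_x[f(y) − f(x)] = E_x[f(x)·φ(x_r)] with φ(v) = 1[σ⁻¹ v < v] − 1[v < σ v], which has mean
-- zero and values in [−1, 1].  Averaging over the choices, D = E_x[f(x)·S(x)] with
-- S(x) = Σ_r ψ(x_r), where ψ has mean zero and |ψ| ≤ 1.  Independence of the coordinates gives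
-- E[S²] ≤ d, and Cauchy–Schwarz with f² = f gives D² ≤ d.  Hence if (Ĩ⁻_f)² ≤ d, then
-- Ĩ_f² = (2 Ĩ⁻_f + D)² ≤ 3 (2 (Ĩ⁻_f)² + D²) ≤ 9d, contradicting Ĩ_f > 9√d.

module Submission where

open import Defs
open import Data.Nat using (ℕ)
open import Data.Bool using (Bool)
open import Data.Fin using (Fin)
open import Data.Vec using (Vec)

open import Data.Bool using (true; false; if_then_else_; not)
import Data.Fin as Fin
open import Data.Fin using (toℕ)
open import Data.Fin.Permutation using (Permutation′; permutation; _⟨$⟩ʳ_; _⟨$⟩ˡ_; inverseˡ; inverseʳ)
open import Data.Fin.Properties using (toℕ-fromℕ<; toℕ-injective; toℕ<n)
import Data.Integer as ℤ
import Data.Integer.Properties as ℤₚ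
open import Data.List using (List; []; _∷_; map; _++_; concatMap; length; allFin; tabulate; applyUpTo; upTo; filterᵇ)
open import Data.List.Membership.Propositional using (_∈_)
open import Data.List.Membership.Propositional.Properties using (∈-applyUpTo⁻; ∈-upTo⁻)
import Data.List.Properties as Listₚ
open import Data.List.Relation.Unary.Any using (here; there)
open import Data.Nat as ℕ using (zero; suc; _∸_; _^_; _<ᵇ_; _≡ᵇ_; NonZero)
open import Data.Nat.DivMod using (_%_; _mod_; %-distribˡ-+; m%n%n≡m%n; %-remove-+ʳ; m<n⇒m%n≡m; m%n≤n; n%n≡0)
open import Data.Nat.Divisibility using (_∣_; m%n≡0⇒n∣m)
import Data.Nat.Properties as ℕₚ
open import Data.Product using (Σ; _,_)
open import Data.Rational using (ℚ; 0ℚ; 1ℚ; _+_; _*_; -_; _-_; _/_; _≤_; _<_; toℚᵘ; nonNegative; nonPositive)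
open import Data.Rational.Properties
open import Algebra.Properties.CommutativeMonoid.Sum +-0-commutativeMonoid using (∑-permute; sum)
open import Data.Rational.Solver using (module +-*-Solver)
open +-*-Solver
import Data.Rational.Unnormalised as ℚᵘ
import Data.Rational.Unnormalised.Properties as ℚᵘₚ
open import Data.Sum using (_⊎_; inj₁; inj₂)
open import Data.Unit using (tt)
open import Data.Vec using ([]; _∷_; lookup; _[_]≔_)
import Data.Vec.Properties as Vecₚ
open import Relation.Binary.PropositionalEquality

fromℕ-+ : ∀ a b → fromℕ (a ℕ.+ b) ≡ fromℕ a + fromℕ b
fromℕ-+ a b = toℚᵘ-injective (begin
  toℚᵘ (fromℕ (a ℕ.+ b))              ≈⟨ toℚᵘ-fromℕ (a ℕ.+ b) ⟩
  ℚᵘ.mkℚᵘ (ℤ.+ (a ℕ.+ b)) 0            ≈⟨ ℚᵘ.*≡* (cong₂ ℤ._*_ +[a+b]≡ refl) ⟩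
  ℚᵘ.mkℚᵘ (ℤ.+ a) 0 ℚᵘ.+ ℚᵘ.mkℚᵘ (ℤ.+ b) 0 ≈⟨ ℚᵘₚ.+-cong (toℚᵘ-fromℕ a) (toℚᵘ-fromℕ b) ⟨
  toℚᵘ (fromℕ a) ℚᵘ.+ toℚᵘ (fromℕ b)   ≈⟨ toℚᵘ-homo-+ (fromℕ a) (fromℕ b) ⟨
  toℚᵘ (fromℕ a + fromℕ b)             ∎)
  where
  open ℚᵘₚ.≃-Reasoning
  toℚᵘ-fromℕ : ∀ m → toℚᵘ (fromℕ m) ℚᵘ.≃ ℚᵘ.mkℚᵘ (ℤ.+ m) 0
  toℚᵘ-fromℕ m = toℚᵘ-fromℚᵘ (ℚᵘ.mkℚᵘ (ℤ.+ m) 0)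
  +[a+b]≡ : ℤ.+ (a ℕ.+ b) ≡ (ℤ.+ a) ℤ.* (ℤ.+ 1) ℤ.+ (ℤ.+ b) ℤ.* (ℤ.+ 1)
  +[a+b]≡ = trans (ℤₚ.pos-+ a b) (sym (cong₂ ℤ._+_ (ℤₚ.*-identityʳ (ℤ.+ a)) (ℤₚ.*-identityʳ (ℤ.+ b))))

fromℕ-* : ∀ a b → fromℕ (a ℕ.* b) ≡ fromℕ a * fromℕ b
fromℕ-* zero    b = sym (*-zeroˡ (fromℕ b))
fromℕ-* (suc a) b = begin
  fromℕ (b ℕ.+ a ℕ.* b)         ≡⟨ fromℕ-+ b (a ℕ.* b) ⟩
  fromℕ b + fromℕ (a ℕ.* b)     ≡⟨ cong (fromℕ b +_) (fromℕ-* a b) ⟩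
  fromℕ b + fromℕ a * fromℕ b   ≡⟨ solve 2 (λ a b → b :+ a :* b := (con 1ℚ :+ a) :* b) refl (fromℕ a) (fromℕ b) ⟩
  (1ℚ + fromℕ a) * fromℕ b      ≡⟨ cong (_* fromℕ b) (fromℕ-+ 1 a) ⟨
  fromℕ (suc a) * fromℕ b       ∎
  where
  open ≡-Reasoning

fromℕ-nonNeg : ∀ m → 0ℚ ≤ fromℕ m
fromℕ-nonNeg m = nonNegative⁻¹ _ {{normalize-nonNeg m 1}}

fromℕ-mono-≤ : ∀ {a b} → a ℕ.≤ b → fromℕ a ≤ fromℕ b
fromℕ-mono-≤ {a} a≤b with ℕₚ.m≤n⇒∃[o]m+o≡n a≤b
... | o , refl = begin
  fromℕ a             ≡⟨ +-identityʳ (fromℕ a) ⟨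
  fromℕ a + 0ℚ        ≤⟨ +-monoʳ-≤ (fromℕ a) (fromℕ-nonNeg o) ⟩
  fromℕ a + fromℕ o   ≡⟨ fromℕ-+ a o ⟨
  fromℕ (a ℕ.+ o)     ∎
  where open ≤-Reasoning

fromℕ-*-inverse : ∀ m → fromℕ (suc m) * ((ℤ.+ 1) / suc m) ≡ 1ℚ
fromℕ-*-inverse m = toℚᵘ-injective (begin
  toℚᵘ (fromℕ (suc m) * ((ℤ.+ 1) / suc m))                   ≈⟨ toℚᵘ-homo-* (fromℕ (suc m)) ((ℤ.+ 1) / suc m) ⟩
  toℚᵘ (fromℕ (suc m)) ℚᵘ.* toℚᵘ ((ℤ.+ 1) / suc m)
    ≈⟨ ℚᵘₚ.*-cong (toℚᵘ-fromℚᵘ (ℚᵘ.mkℚᵘ (ℤ.+ suc m) 0)) (toℚᵘ-fromℚᵘ (ℚᵘ.mkℚᵘ (ℤ.+ 1) m)) ⟩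
  ℚᵘ.mkℚᵘ (ℤ.+ suc m) 0 ℚᵘ.* ℚᵘ.mkℚᵘ (ℤ.+ 1) m                 ≈⟨ ℚᵘ.*≡* cross-multiplied ⟩
  ℚᵘ.1ℚᵘ                                                    ∎)
  where
  open ℚᵘₚ.≃-Reasoning
  1+m = ℤ.+ suc m
  cross-multiplied : (1+m ℤ.* ℤ.1ℤ) ℤ.* ℤ.1ℤ ≡ ℤ.1ℤ ℤ.* (ℤ.1ℤ ℤ.* 1+m)
  cross-multiplied = trans (ℤₚ.*-identityʳ (1+m ℤ.* ℤ.1ℤ)) (trans (ℤₚ.*-identityʳ 1+m)
    (sym (trans (ℤₚ.*-identityˡ (ℤ.1ℤ ℤ.* 1+m)) (ℤₚ.*-identityˡ 1+m))))

*-nonNeg : ∀ {p q} → 0ℚ ≤ p → 0ℚ ≤ q → 0ℚ ≤ p * q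
*-nonNeg {p} {q} 0≤p 0≤q = nonNegative⁻¹ _ {{nonNeg*nonNeg⇒nonNeg p {{nonNegative 0≤p}} q {{nonNegative 0≤q}}}}

square-nonNeg : ∀ p → 0ℚ ≤ p * p
square-nonNeg p with ≤-total 0ℚ p
... | inj₁ 0≤p = *-nonNeg 0≤p 0≤p
... | inj₂ p≤0 = nonNegative⁻¹ _ {{nonPos*nonPos⇒nonPos p {{nonPositive p≤0}} p {{nonPositive p≤0}}}}

square-≤-1 : ∀ p → - 1ℚ ≤ p → p ≤ 1ℚ → p * p ≤ 1ℚ
square-≤-1 p -1≤p p≤1 = begin
  p * p                              ≡⟨ +-identityʳ (p * p) ⟨
  p * p + 0ℚ                         ≤⟨ +-monoʳ-≤ (p * p) (*-nonNeg 0≤1-p 0≤1+p) ⟩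
  p * p + (1ℚ - p) * (1ℚ + p)        ≡⟨ solve 1 (λ p → p :* p :+ (con 1ℚ :- p) :* (con 1ℚ :+ p) := con 1ℚ) refl p ⟩
  1ℚ                                 ∎
  where
  open ≤-Reasoning
  0≤1-p : 0ℚ ≤ 1ℚ - p
  0≤1-p = subst (_≤ 1ℚ - p) (+-inverseʳ p) (+-monoˡ-≤ (- p) p≤1)
  0≤1+p : 0ℚ ≤ 1ℚ + p
  0≤1+p = subst (_≤ 1ℚ + p) (+-inverseʳ 1ℚ) (+-monoʳ-≤ 1ℚ -1≤p)

[2a+b]²≤9d : ∀ a b d → a * a ≤ fromℕ d → b * b ≤ fromℕ d →
  (fromℕ 2 * a + b) * (fromℕ 2 * a + b) ≤ fromℕ (9 ℕ.* d)
[2a+b]²≤9d a b d a²≤d b²≤d = begin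
  s * s                                    ≡⟨ +-identityʳ (s * s) ⟨
  s * s + 0ℚ                               ≤⟨ +-monoʳ-≤ (s * s) (*-nonNeg (fromℕ-nonNeg 2) (square-nonNeg (a - b))) ⟩
  s * s + fromℕ 2 * ((a - b) * (a - b))    ≡⟨ lagrange ⟩
  fromℕ 6 * (a * a) + fromℕ 3 * (b * b)    ≤⟨ +-mono-≤ (scale 6 a²≤d) (scale 3 b²≤d) ⟩
  fromℕ 6 * fromℕ d + fromℕ 3 * fromℕ d    ≡⟨ cong₂ _+_ (fromℕ-* 6 d) (fromℕ-* 3 d) ⟨
  fromℕ (6 ℕ.* d) + fromℕ (3 ℕ.* d)        ≡⟨ fromℕ-+ (6 ℕ.* d) (3 ℕ.* d) ⟨
  fromℕ (6 ℕ.* d ℕ.+ 3 ℕ.* d)              ≡⟨ cong fromℕ (ℕₚ.*-distribʳ-+ d 6 3) ⟨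
  fromℕ (9 ℕ.* d)                          ∎
  where
  open ≤-Reasoning
  s = fromℕ 2 * a + b
  lagrange : s * s + fromℕ 2 * ((a - b) * (a - b)) ≡ fromℕ 6 * (a * a) + fromℕ 3 * (b * b)
  lagrange = solve 2 (λ a b → (con (fromℕ 2) :* a :+ b) :* (con (fromℕ 2) :* a :+ b) :+ con (fromℕ 2) :* ((a :- b) :* (a :- b))
                              := con (fromℕ 6) :* (a :* a) :+ con (fromℕ 3) :* (b :* b)) refl a b
  scale : ∀ c {p q} → p ≤ q → fromℕ c * p ≤ fromℕ c * q
  scale c = *-monoˡ-≤-nonNeg (fromℕ c) {{nonNegative (fromℕ-nonNeg c)}}

81d<[2a+b]²⇒d<a² : ∀ a b d → b * b ≤ fromℕ d →
  fromℕ (81 ℕ.* d) < (fromℕ 2 * a + b) * (fromℕ 2 * a + b) → fromℕ d < a * a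
81d<[2a+b]²⇒d<a² a b d b²≤d 81d<[2a+b]² = ≰⇒> λ a²≤d → <-irrefl refl (<-≤-trans 81d<[2a+b]² (begin
  (fromℕ 2 * a + b) * (fromℕ 2 * a + b)   ≤⟨ [2a+b]²≤9d a b d a²≤d b²≤d ⟩
  fromℕ (9 ℕ.* d)                         ≤⟨ fromℕ-mono-≤ (ℕₚ.*-monoˡ-≤ d (ℕₚ.m≤m+n 9 72)) ⟩
  fromℕ (81 ℕ.* d)                        ∎))
  where open ≤-Reasoning

𝟙-nonNeg : ∀ b → 0ℚ ≤ 𝟙 b
𝟙-nonNeg true  = ≤ᵇ⇒≤ tt
𝟙-nonNeg false = ≤-refl

𝟙-difference-≤ : ∀ a b → 𝟙 a - 𝟙 b ≤ 1ℚ
𝟙-difference-≤ true  true  = ≤ᵇ⇒≤ tt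
𝟙-difference-≤ true  false = ≤ᵇ⇒≤ tt
𝟙-difference-≤ false true  = ≤ᵇ⇒≤ tt
𝟙-difference-≤ false false = ≤ᵇ⇒≤ tt

𝟙-difference-≥ : ∀ a b → - 1ℚ ≤ 𝟙 a - 𝟙 b
𝟙-difference-≥ true  true  = ≤ᵇ⇒≤ tt
𝟙-difference-≥ true  false = ≤ᵇ⇒≤ tt
𝟙-difference-≥ false true  = ≤ᵇ⇒≤ tt
𝟙-difference-≥ false false = ≤ᵇ⇒≤ tt

𝟙-neqB : ∀ a b → 𝟙 (neqB a b) ≡ fromℕ 2 * 𝟙 (gtB a b) + (𝟙 b - 𝟙 a)
𝟙-neqB true  true  = refl
𝟙-neqB true  false = refl
𝟙-neqB false true  = refl
𝟙-neqB false false = refl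

module _ {A : Set} where

  sumQ-cong-∈ : (l : List A) {g h : A → ℚ} → (∀ a → a ∈ l → g a ≡ h a) → sumQ l g ≡ sumQ l h
  sumQ-cong-∈ []      e = refl
  sumQ-cong-∈ (a ∷ l) e = cong₂ _+_ (e a (here refl)) (sumQ-cong-∈ l (λ b b∈l → e b (there b∈l)))

  sumQ-cong : (l : List A) {g h : A → ℚ} → (∀ a → g a ≡ h a) → sumQ l g ≡ sumQ l h
  sumQ-cong l e = sumQ-cong-∈ l (λ a _ → e a)

  sumQ-+ : (l : List A) (g h : A → ℚ) → sumQ l (λ a → g a + h a) ≡ sumQ l g + sumQ l h
  sumQ-+ []      g h = refl
  sumQ-+ (a ∷ l) g h = trans (cong ((g a + h a) +_) (sumQ-+ l g h))
    (solve 4 (λ x y X Y → (x :+ y) :+ (X :+ Y) := (x :+ X) :+ (y :+ Y)) refl (g a) (h a) (sumQ l g) (sumQ l h))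

  sumQ-*ˡ : (l : List A) (c : ℚ) (g : A → ℚ) → sumQ l (λ a → c * g a) ≡ c * sumQ l g
  sumQ-*ˡ []      c g = sym (*-zeroʳ c)
  sumQ-*ˡ (a ∷ l) c g = trans (cong (c * g a +_) (sumQ-*ˡ l c g)) (sym (*-distribˡ-+ c (g a) (sumQ l g)))

  sumQ-*ʳ : (l : List A) (c : ℚ) (g : A → ℚ) → sumQ l (λ a → g a * c) ≡ sumQ l g * c
  sumQ-*ʳ []      c g = sym (*-zeroˡ c)
  sumQ-*ʳ (a ∷ l) c g = trans (cong (g a * c +_) (sumQ-*ʳ l c g)) (sym (*-distribʳ-+ c (g a) (sumQ l g)))

  sumQ-neg : (l : List A) (g : A → ℚ) → sumQ l (λ a → - g a) ≡ - sumQ l g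
  sumQ-neg []      g = refl
  sumQ-neg (a ∷ l) g = trans (cong (- g a +_) (sumQ-neg l g)) (sym (neg-distrib-+ (g a) (sumQ l g)))

  sumQ-- : (l : List A) (g h : A → ℚ) → sumQ l (λ a → g a - h a) ≡ sumQ l g - sumQ l h
  sumQ-- l g h = trans (sumQ-+ l g (λ a → - h a)) (cong (sumQ l g +_) (sumQ-neg l h))

  sumQ-zero : (l : List A) → sumQ l (λ _ → 0ℚ) ≡ 0ℚ
  sumQ-zero []      = refl
  sumQ-zero (a ∷ l) = trans (+-identityˡ _) (sumQ-zero l)

  sumQ-const : (l : List A) (c : ℚ) → sumQ l (λ _ → c) ≡ fromℕ (length l) * c
  sumQ-const []      c = sym (*-zeroˡ c)
  sumQ-const (a ∷ l) c = begin
    c + sumQ l (λ _ → c)           ≡⟨ cong (c +_) (sumQ-const l c) ⟩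
    c + fromℕ (length l) * c       ≡⟨ solve 2 (λ c m → c :+ m :* c := (con 1ℚ :+ m) :* c) refl c (fromℕ (length l)) ⟩
    (1ℚ + fromℕ (length l)) * c    ≡⟨ cong (_* c) (fromℕ-+ 1 (length l)) ⟨
    fromℕ (suc (length l)) * c     ∎
    where
    open ≡-Reasoning

  sumQ-mono-≤ : (l : List A) {g h : A → ℚ} → (∀ a → g a ≤ h a) → sumQ l g ≤ sumQ l h
  sumQ-mono-≤ []      e = ≤-refl
  sumQ-mono-≤ (a ∷ l) e = +-mono-≤ (e a) (sumQ-mono-≤ l e)

  sumQ-++ : (l m : List A) (g : A → ℚ) → sumQ (l ++ m) g ≡ sumQ l g + sumQ m g
  sumQ-++ []      m g = sym (+-identityˡ _)
  sumQ-++ (a ∷ l) m g = trans (cong (g a +_) (sumQ-++ l m g)) (sym (+-assoc (g a) (sumQ l g) (sumQ m g)))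

module _ {A B : Set} where

  sumQ-comm : (l : List A) (m : List B) (g : A → B → ℚ) →
    sumQ l (λ a → sumQ m (g a)) ≡ sumQ m (λ b → sumQ l (λ a → g a b))
  sumQ-comm []      m g = sym (sumQ-zero m)
  sumQ-comm (a ∷ l) m g = trans (cong (sumQ m (g a) +_) (sumQ-comm l m g))
    (sym (sumQ-+ m (g a) (λ b → sumQ l (λ a′ → g a′ b))))

  sumQ-map : (f : A → B) (l : List A) (g : B → ℚ) → sumQ (map f l) g ≡ sumQ l (λ a → g (f a))
  sumQ-map f []      g = refl
  sumQ-map f (a ∷ l) g = cong (g (f a) +_) (sumQ-map f l g)

  sumQ-concatMap : (f : A → List B) (l : List A) (g : B → ℚ) →
    sumQ (concatMap f l) g ≡ sumQ l (λ a → sumQ (f a) g)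
  sumQ-concatMap f []      g = refl
  sumQ-concatMap f (a ∷ l) g =
    trans (sumQ-++ (f a) (concatMap f l) g) (cong (sumQ (f a) g +_) (sumQ-concatMap f l g))

avgWeight : ∀ {A : Set} → List A → ℚ
avgWeight []      = 0ℚ
avgWeight (a ∷ l) = (ℤ.+ 1) / suc (length l)

avgWeight-nonNeg : ∀ {A : Set} (l : List A) → 0ℚ ≤ avgWeight l
avgWeight-nonNeg []      = ≤-refl
avgWeight-nonNeg (a ∷ l) = nonNegative⁻¹ _ {{normalize-nonNeg 1 (suc (length l))}}

module _ {A : Set} where

  avg≡sumQ*avgWeight : (l : List A) (g : A → ℚ) → avg l g ≡ sumQ l g * avgWeight l
  avg≡sumQ*avgWeight []      g = refl
  avg≡sumQ*avgWeight (a ∷ l) g = refl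

  avg-cong-∈ : (l : List A) {g h : A → ℚ} → (∀ a → a ∈ l → g a ≡ h a) → avg l g ≡ avg l h
  avg-cong-∈ l {g} {h} e = begin
    avg l g                    ≡⟨ avg≡sumQ*avgWeight l g ⟩
    sumQ l g * avgWeight l     ≡⟨ cong (_* avgWeight l) (sumQ-cong-∈ l e) ⟩
    sumQ l h * avgWeight l     ≡⟨ avg≡sumQ*avgWeight l h ⟨
    avg l h                    ∎
    where open ≡-Reasoning

  avg-cong : (l : List A) {g h : A → ℚ} → (∀ a → g a ≡ h a) → avg l g ≡ avg l h
  avg-cong l e = avg-cong-∈ l (λ a _ → e a)

  avg-linear : (l : List A) (c : ℚ) (g h : A → ℚ) → avg l (λ a → c * g a + h a) ≡ c * avg l g + avg l h
  avg-linear l c g h = begin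
    avg l (λ a → c * g a + h a)                       ≡⟨ avg≡sumQ*avgWeight l _ ⟩
    sumQ l (λ a → c * g a + h a) * w                  ≡⟨ cong (_* w) (sumQ-+ l (λ a → c * g a) h) ⟩
    (sumQ l (λ a → c * g a) + sumQ l h) * w           ≡⟨ cong (λ s → (s + sumQ l h) * w) (sumQ-*ˡ l c g) ⟩
    (c * sumQ l g + sumQ l h) * w                     ≡⟨ solve 4 (λ c G H w → (c :* G :+ H) :* w := c :* (G :* w) :+ H :* w) refl c (sumQ l g) (sumQ l h) w ⟩
    c * (sumQ l g * w) + sumQ l h * w                 ≡⟨ cong₂ (λ u v → c * u + v) (avg≡sumQ*avgWeight l g) (avg≡sumQ*avgWeight l h) ⟨
    c * avg l g + avg l h                             ∎
    where
    open ≡-Reasoning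
    w = avgWeight l

  avg-zero : (l : List A) → avg l (λ _ → 0ℚ) ≡ 0ℚ
  avg-zero l = trans (avg≡sumQ*avgWeight l _) (trans (cong (_* avgWeight l) (sumQ-zero l)) (*-zeroˡ (avgWeight l)))

  avg-*ˡ : (l : List A) (c : ℚ) (g : A → ℚ) → avg l (λ a → c * g a) ≡ c * avg l g
  avg-*ˡ l c g = begin
    avg l (λ a → c * g a)                 ≡⟨ avg-cong l (λ a → +-identityʳ (c * g a)) ⟨
    avg l (λ a → c * g a + 0ℚ)            ≡⟨ avg-linear l c g (λ _ → 0ℚ) ⟩
    c * avg l g + avg l (λ _ → 0ℚ)        ≡⟨ cong (c * avg l g +_) (avg-zero l) ⟩
    c * avg l g + 0ℚ                      ≡⟨ +-identityʳ (c * avg l g) ⟩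
    c * avg l g                           ∎
    where open ≡-Reasoning

  avg-mono-≤ : (l : List A) {g h : A → ℚ} → (∀ a → g a ≤ h a) → avg l g ≤ avg l h
  avg-mono-≤ l {g} {h} e = begin
    avg l g                   ≡⟨ avg≡sumQ*avgWeight l g ⟩
    sumQ l g * avgWeight l    ≤⟨ *-monoʳ-≤-nonNeg (avgWeight l) {{nonNegative (avgWeight-nonNeg l)}} (sumQ-mono-≤ l e) ⟩
    sumQ l h * avgWeight l    ≡⟨ avg≡sumQ*avgWeight l h ⟨
    avg l h                   ∎
    where open ≤-Reasoning

  length*avg≡sumQ : (l : List A) (g : A → ℚ) → fromℕ (length l) * avg l g ≡ sumQ l g
  length*avg≡sumQ []      g = refl
  length*avg≡sumQ (a ∷ l) g = begin
    fromℕ (suc (length l)) * (sumQ (a ∷ l) g * w)   ≡⟨ solve 3 (λ m s w → m :* (s :* w) := s :* (m :* w)) refl (fromℕ (suc (length l))) (sumQ (a ∷ l) g) w ⟩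
    sumQ (a ∷ l) g * (fromℕ (suc (length l)) * w)   ≡⟨ cong (sumQ (a ∷ l) g *_) (fromℕ-*-inverse (length l)) ⟩
    sumQ (a ∷ l) g * 1ℚ                              ≡⟨ *-identityʳ _ ⟩
    sumQ (a ∷ l) g                                   ∎
    where
    open ≡-Reasoning
    w = avgWeight (a ∷ l)

  avg-const : (a : A) (l : List A) (c : ℚ) → avg (a ∷ l) (λ _ → c) ≡ c
  avg-const a l c = begin
    sumQ (a ∷ l) (λ _ → c) * w          ≡⟨ cong (_* w) (sumQ-const (a ∷ l) c) ⟩
    (m * c) * w                         ≡⟨ solve 3 (λ m c w → (m :* c) :* w := c :* (m :* w)) refl m c w ⟩
    c * (m * w)                         ≡⟨ cong (c *_) (fromℕ-*-inverse (length l)) ⟩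
    c * 1ℚ                              ≡⟨ *-identityʳ c ⟩
    c                                   ∎
    where
    open ≡-Reasoning
    w = avgWeight (a ∷ l)
    m = fromℕ (suc (length l))

  avg-cong-sumQ : (l : List A) {g h : A → ℚ} → sumQ l g ≡ sumQ l h → avg l g ≡ avg l h
  avg-cong-sumQ l {g} {h} e = trans (avg≡sumQ*avgWeight l g) (trans (cong (_* avgWeight l) e) (sym (avg≡sumQ*avgWeight l h)))

  avg-≤ : (l : List A) {g : A → ℚ} (c : ℚ) → 0ℚ ≤ c → (∀ a → g a ≤ c) → avg l g ≤ c
  avg-≤ []      c 0≤c g≤c = 0≤c
  avg-≤ (a ∷ l) c 0≤c g≤c = ≤-trans (avg-mono-≤ (a ∷ l) g≤c) (≤-reflexive (avg-const a l c))

  avg-≥ : (l : List A) {g : A → ℚ} (c : ℚ) → c ≤ 0ℚ → (∀ a → c ≤ g a) → c ≤ avg l g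
  avg-≥ []      c c≤0 c≤g = c≤0
  avg-≥ (a ∷ l) c c≤0 c≤g = ≤-trans (≤-reflexive (sym (avg-const a l c))) (avg-mono-≤ (a ∷ l) c≤g)

module _ {A B : Set} where

  avg-comm : (l : List A) (m : List B) (g : A → B → ℚ) →
    avg l (λ a → avg m (g a)) ≡ avg m (λ b → avg l (λ a → g a b))
  avg-comm l m g = begin
    avg l (λ a → avg m (g a))                                  ≡⟨ avg≡sumQ*avgWeight l _ ⟩
    sumQ l (λ a → avg m (g a)) * wl                            ≡⟨ cong (_* wl) (sumQ-cong l (λ a → avg≡sumQ*avgWeight m (g a))) ⟩
    sumQ l (λ a → sumQ m (g a) * wm) * wl                      ≡⟨ cong (_* wl) (sumQ-*ʳ l wm _) ⟩
    (sumQ l (λ a → sumQ m (g a)) * wm) * wl                    ≡⟨ cong (λ s → (s * wm) * wl) (sumQ-comm l m g) ⟩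
    (S * wm) * wl                                              ≡⟨ solve 3 (λ S x y → (S :* x) :* y := (S :* y) :* x) refl S wm wl ⟩
    (S * wl) * wm                                              ≡⟨ cong (_* wm) (sumQ-*ʳ m wl _) ⟨
    sumQ m (λ b → sumQ l (λ a → g a b) * wl) * wm              ≡⟨ cong (_* wm) (sumQ-cong m (λ b → avg≡sumQ*avgWeight l (λ a → g a b))) ⟨
    sumQ m (λ b → avg l (λ a → g a b)) * wm                    ≡⟨ avg≡sumQ*avgWeight m _ ⟨
    avg m (λ b → avg l (λ a → g a b))                          ∎
    where
    open ≡-Reasoning
    wl = avgWeight l
    wm = avgWeight m
    S = sumQ m (λ b → sumQ l (λ a → g a b))

  avg-sumQ-comm : (l : List A) (m : List B) (g : A → B → ℚ) →
    avg l (λ a → sumQ m (g a)) ≡ sumQ m (λ b → avg l (λ a → g a b))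
  avg-sumQ-comm l m g = begin
    avg l (λ a → sumQ m (g a))                                 ≡⟨ avg≡sumQ*avgWeight l _ ⟩
    sumQ l (λ a → sumQ m (g a)) * avgWeight l                  ≡⟨ cong (_* avgWeight l) (sumQ-comm l m g) ⟩
    sumQ m (λ b → sumQ l (λ a → g a b)) * avgWeight l          ≡⟨ sumQ-*ʳ m (avgWeight l) _ ⟨
    sumQ m (λ b → sumQ l (λ a → g a b) * avgWeight l)          ≡⟨ sumQ-cong m (λ b → avg≡sumQ*avgWeight l (λ a → g a b)) ⟨
    sumQ m (λ b → avg l (λ a → g a b))                         ∎
    where open ≡-Reasoning

sumQ-allFin-suc : ∀ n (g : Fin (suc n) → ℚ) → sumQ (allFin (suc n)) g ≡ g Fin.zero + sumQ (allFin n) (λ i → g (Fin.suc i))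
sumQ-allFin-suc n g = cong (g Fin.zero +_) (begin
  sumQ (tabulate Fin.suc) g             ≡⟨ cong (λ l → sumQ l g) (Listₚ.map-tabulate (λ i → i) Fin.suc) ⟨
  sumQ (map Fin.suc (allFin n)) g       ≡⟨ sumQ-map Fin.suc (allFin n) g ⟩
  sumQ (allFin n) (λ i → g (Fin.suc i)) ∎)
  where open ≡-Reasoning

sumQ-allFin≡sum : ∀ n (g : Fin n → ℚ) → sumQ (allFin n) g ≡ sum g
sumQ-allFin≡sum zero    g = refl
sumQ-allFin≡sum (suc n) g = trans (sumQ-allFin-suc n g) (cong (g Fin.zero +_) (sumQ-allFin≡sum n (λ i → g (Fin.suc i))))

sumQ-allFin-permute : ∀ {n} (π : Permutation′ n) (g : Fin n → ℚ) →
  sumQ (allFin n) (λ v → g (π ⟨$⟩ʳ v)) ≡ sumQ (allFin n) g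
sumQ-allFin-permute {n} π g = begin
  sumQ (allFin n) (λ v → g (π ⟨$⟩ʳ v))  ≡⟨ sumQ-allFin≡sum n _ ⟩
  sum (λ v → g (π ⟨$⟩ʳ v))           ≡⟨ ∑-permute g π ⟨
  sum g                                  ≡⟨ sumQ-allFin≡sum n g ⟨
  sumQ (allFin n) g                      ∎
  where open ≡-Reasoning

sumQ-allVecs-suc : ∀ n d (H : Vec (Fin n) (suc d) → ℚ) →
  sumQ (allVecs n (suc d)) H ≡ sumQ (allFin n) (λ a → sumQ (allVecs n d) (λ xs → H (a ∷ xs)))
sumQ-allVecs-suc n d H =
  trans (sumQ-concatMap _ (allFin n) H) (sumQ-cong (allFin n) (λ a → sumQ-map (a ∷_) (allVecs n d) H))

sumQ-allVecs-permute-coordinate : ∀ {n d} (π : Permutation′ n) (r : Fin d) (H : Vec (Fin n) d → ℚ) →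
  sumQ (allVecs n d) (λ x → H (x [ r ]≔ (π ⟨$⟩ʳ lookup x r))) ≡ sumQ (allVecs n d) H
sumQ-allVecs-permute-coordinate {n} {suc d} π Fin.zero H = begin
  sumQ (allVecs n (suc d)) (λ x → H (x [ Fin.zero ]≔ (π ⟨$⟩ʳ lookup x Fin.zero))) ≡⟨ sumQ-allVecs-suc n d _ ⟩
  sumQ (allFin n) (λ a → sumQ (allVecs n d) (λ xs → H ((π ⟨$⟩ʳ a) ∷ xs))) ≡⟨ sumQ-allFin-permute π (λ a → sumQ (allVecs n d) (λ xs → H (a ∷ xs))) ⟩
  sumQ (allFin n) (λ a → sumQ (allVecs n d) (λ xs → H (a ∷ xs)))       ≡⟨ sumQ-allVecs-suc n d H ⟨
  sumQ (allVecs n (suc d)) H                                             ∎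
  where open ≡-Reasoning
sumQ-allVecs-permute-coordinate {n} {suc d} π (Fin.suc r) H = begin
  sumQ (allVecs n (suc d)) (λ x → H (x [ Fin.suc r ]≔ (π ⟨$⟩ʳ lookup x (Fin.suc r))))       ≡⟨ sumQ-allVecs-suc n d _ ⟩
  sumQ (allFin n) (λ a → sumQ (allVecs n d) (λ xs → H (a ∷ (xs [ r ]≔ (π ⟨$⟩ʳ lookup xs r)))))
    ≡⟨ sumQ-cong (allFin n) (λ a → sumQ-allVecs-permute-coordinate π r (λ xs → H (a ∷ xs))) ⟩
  sumQ (allFin n) (λ a → sumQ (allVecs n d) (λ xs → H (a ∷ xs)))                            ≡⟨ sumQ-allVecs-suc n d H ⟨
  sumQ (allVecs n (suc d)) H                                                                  ∎
  where open ≡-Reasoning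

allVecs-nonEmpty : ∀ {n} → Fin n → ∀ d → Σ (Vec (Fin n) d) λ x → Σ (List (Vec (Fin n) d)) λ xs → allVecs n d ≡ x ∷ xs
allVecs-nonEmpty v zero = [] , [] , refl
allVecs-nonEmpty {suc n} v (suc d) with allVecs-nonEmpty v d
... | x , xs , eq = Fin.zero ∷ x , _ , cong (λ l → map (Fin.zero ∷_) l ++ concatMap (λ a → map (a ∷_) (allVecs (suc n) d)) (tabulate Fin.suc)) eq

avg-allVecs-const : ∀ {n} → Fin n → ∀ d (c : ℚ) → avg (allVecs n d) (λ _ → c) ≡ c
avg-allVecs-const v d c with allVecs-nonEmpty v d
... | x , xs , eq rewrite eq = avg-const x xs c

coordSum : ∀ {n d} → (Fin n → ℚ) → Vec (Fin n) d → ℚ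
coordSum ψ []      = 0ℚ
coordSum ψ (a ∷ x) = ψ a + coordSum ψ x

sumQ-allFin-lookup≡coordSum : ∀ {n d} (ψ : Fin n → ℚ) (x : Vec (Fin n) d) →
  sumQ (allFin d) (λ r → ψ (lookup x r)) ≡ coordSum ψ x
sumQ-allFin-lookup≡coordSum ψ []              = refl
sumQ-allFin-lookup≡coordSum ψ (_∷_ {d} a x) =
  trans (sumQ-allFin-suc d (λ r → ψ (lookup (a ∷ x) r))) (cong (ψ a +_) (sumQ-allFin-lookup≡coordSum ψ x))

module _ {n} (ψ : Fin n → ℚ) (∑ψ≡0 : sumQ (allFin n) ψ ≡ 0ℚ) where

  sumQ-coordSum : ∀ d → sumQ (allVecs n d) (coordSum ψ) ≡ 0ℚ
  sumQ-coordSum zero    = refl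
  sumQ-coordSum (suc d) = begin
    sumQ (allVecs n (suc d)) (coordSum ψ)                                    ≡⟨ sumQ-allVecs-suc n d (coordSum ψ) ⟩
    sumQ (allFin n) (λ a → sumQ X (λ x → ψ a + coordSum ψ x))                ≡⟨ sumQ-cong (allFin n) (λ a → sumQ-+ X (λ _ → ψ a) (coordSum ψ)) ⟩
    sumQ (allFin n) (λ a → sumQ X (λ _ → ψ a) + sumQ X (coordSum ψ))         ≡⟨ sumQ-cong (allFin n) (λ a → cong₂ _+_ (sumQ-const X (ψ a)) (sumQ-coordSum d)) ⟩
    sumQ (allFin n) (λ a → m * ψ a + 0ℚ)                                     ≡⟨ sumQ-cong (allFin n) (λ a → +-identityʳ (m * ψ a)) ⟩
    sumQ (allFin n) (λ a → m * ψ a)                                          ≡⟨ sumQ-*ˡ (allFin n) m ψ ⟩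
    m * sumQ (allFin n) ψ                                                    ≡⟨ cong (m *_) ∑ψ≡0 ⟩
    m * 0ℚ                                                                   ≡⟨ *-zeroʳ m ⟩
    0ℚ                                                                       ∎
    where
    open ≡-Reasoning
    X = allVecs n d
    m = fromℕ (length X)

  -- Expanding (ψ a + coordSum ψ x)², the cross term sums to zero since coordSum ψ has mean zero.
  sumQ-coordSum²-≤ : (∀ v → ψ v * ψ v ≤ 1ℚ) → ∀ d →
    sumQ (allVecs n d) (λ x → coordSum ψ x * coordSum ψ x) ≤ fromℕ d * sumQ (allVecs n d) (λ _ → 1ℚ)
  sumQ-coordSum²-≤ ψ²≤1 zero    = ≤-refl
  sumQ-coordSum²-≤ ψ²≤1 (suc d) = begin
    sumQ (allVecs n (suc d)) (λ x → S x * S x)                                ≡⟨ sumQ-allVecs-suc n d _ ⟩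
    sumQ (allFin n) (λ a → sumQ X (λ x → (ψ a + S x) * (ψ a + S x)))          ≡⟨ sumQ-cong (allFin n) expand ⟩
    sumQ (allFin n) (λ a → sumQ X (λ _ → ψ a * ψ a) + sumQ X (λ x → S x * S x))
      ≤⟨ sumQ-mono-≤ (allFin n) (λ a → +-mono-≤ (sumQ-mono-≤ X (λ _ → ψ²≤1 a)) (sumQ-coordSum²-≤ ψ²≤1 d)) ⟩
    sumQ (allFin n) (λ a → C + fromℕ d * C)                                   ≡⟨ sumQ-cong (allFin n) (λ _ → solve 2 (λ C m → C :+ m :* C := (con 1ℚ :+ m) :* C) refl C (fromℕ d)) ⟩
    sumQ (allFin n) (λ a → (1ℚ + fromℕ d) * C)                                ≡⟨ sumQ-*ˡ (allFin n) (1ℚ + fromℕ d) (λ _ → C) ⟩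
    (1ℚ + fromℕ d) * sumQ (allFin n) (λ a → C)                                ≡⟨ cong₂ _*_ (fromℕ-+ 1 d) (sumQ-allVecs-suc n d (λ _ → 1ℚ)) ⟨
    fromℕ (suc d) * sumQ (allVecs n (suc d)) (λ _ → 1ℚ)                       ∎
    where
    open ≤-Reasoning
    S : ∀ {d} → Vec (Fin n) d → ℚ
    S = coordSum ψ
    X = allVecs n d
    C = sumQ X (λ _ → 1ℚ)
    expand : ∀ a → sumQ X (λ x → (ψ a + S x) * (ψ a + S x)) ≡ sumQ X (λ _ → ψ a * ψ a) + sumQ X (λ x → S x * S x)
    expand a = begin-equality
      sumQ X (λ x → (ψ a + S x) * (ψ a + S x))
        ≡⟨ sumQ-cong X (λ x → solve 2 (λ p s → (p :+ s) :* (p :+ s) := p :* p :+ ((p :+ p) :* s :+ s :* s)) refl (ψ a) (S x)) ⟩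
      sumQ X (λ x → ψ a * ψ a + ((ψ a + ψ a) * S x + S x * S x))              ≡⟨ sumQ-+ X _ _ ⟩
      sumQ X (λ _ → ψ a * ψ a) + sumQ X (λ x → (ψ a + ψ a) * S x + S x * S x) ≡⟨ cong (sumQ X (λ _ → ψ a * ψ a) +_) (sumQ-+ X _ _) ⟩
      sumQ X (λ _ → ψ a * ψ a) + (sumQ X (λ x → (ψ a + ψ a) * S x) + S²)      ≡⟨ cong (λ c → sumQ X (λ _ → ψ a * ψ a) + (c + S²)) cross≡0 ⟩
      sumQ X (λ _ → ψ a * ψ a) + (0ℚ + S²)                                    ≡⟨ cong (sumQ X (λ _ → ψ a * ψ a) +_) (+-identityˡ S²) ⟩
      sumQ X (λ _ → ψ a * ψ a) + S²                                           ∎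
      where
      S² = sumQ X (λ x → S x * S x)
      cross≡0 : sumQ X (λ x → (ψ a + ψ a) * S x) ≡ 0ℚ
      cross≡0 = trans (sumQ-*ˡ X (ψ a + ψ a) S) (trans (cong ((ψ a + ψ a) *_) (sumQ-coordSum d)) (*-zeroʳ (ψ a + ψ a)))

-- Cauchy–Schwarz with F² ≤ 1, via the pointwise bound 2E·F·S − E² ≤ S²; the hypothesis on
-- constant averages says that l is nonempty.
avg-indicator*-square-≤ : ∀ {A : Set} (l : List A) (F S : A → ℚ) →
  (∀ c → avg l (λ _ → c) ≡ c) → (∀ x → F x ≡ 0ℚ ⊎ F x ≡ 1ℚ) →
  avg l (λ x → F x * S x) * avg l (λ x → F x * S x) ≤ avg l (λ x → S x * S x)
avg-indicator*-square-≤ l F S avg-const′ F∈01 = begin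
  E * E                                                   ≡⟨ solve 1 (λ E → E :* E := (E :+ E) :* E :+ (:- (E :* E))) refl E ⟩
  (E + E) * E + - (E * E)                                 ≡⟨ cong ((E + E) * E +_) (avg-const′ (- (E * E))) ⟨
  (E + E) * E + avg l (λ _ → - (E * E))                   ≡⟨ avg-linear l (E + E) (λ x → F x * S x) (λ _ → - (E * E)) ⟨
  avg l (λ x → (E + E) * (F x * S x) + - (E * E))         ≤⟨ avg-mono-≤ l pointwise ⟩
  avg l (λ x → S x * S x)                                 ∎
  where
  open ≤-Reasoning
  E = avg l (λ x → F x * S x)
  pointwise : ∀ x → (E + E) * (F x * S x) + - (E * E) ≤ S x * S x
  pointwise x with F∈01 x
  ... | inj₁ Fx≡0 rewrite Fx≡0 = begin
    (E + E) * (0ℚ * S x) + - (E * E)    ≡⟨ solve 2 (λ E s → (E :+ E) :* (con 0ℚ :* s) :+ (:- (E :* E)) := con 0ℚ :- E :* E) refl E (S x) ⟩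
    0ℚ - E * E                          ≤⟨ +-monoʳ-≤ 0ℚ (neg-antimono-≤ (square-nonNeg E)) ⟩
    0ℚ - 0ℚ                             ≤⟨ +-monoˡ-≤ (- 0ℚ) (square-nonNeg (S x)) ⟩
    S x * S x - 0ℚ                      ≡⟨ solve 1 (λ s → s :* s :- con 0ℚ := s :* s) refl (S x) ⟩
    S x * S x                           ∎
  ... | inj₂ Fx≡1 rewrite Fx≡1 = begin
    (E + E) * (1ℚ * S x) + - (E * E)    ≡⟨ solve 2 (λ E s → (E :+ E) :* (con 1ℚ :* s) :+ (:- (E :* E)) := s :* s :- (s :- E) :* (s :- E)) refl E (S x) ⟩
    S x * S x - (S x - E) * (S x - E)   ≤⟨ +-monoʳ-≤ (S x * S x) (neg-antimono-≤ (square-nonNeg (S x - E))) ⟩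
    S x * S x - 0ℚ                      ≡⟨ solve 1 (λ s → s :* s :- con 0ℚ := s :* s) refl (S x) ⟩
    S x * S x                           ∎

avg-coordSum²-≤ : ∀ {n} (ψ : Fin n → ℚ) → sumQ (allFin n) ψ ≡ 0ℚ → (∀ v → ψ v * ψ v ≤ 1ℚ) →
  Fin n → ∀ d → avg (allVecs n d) (λ x → coordSum ψ x * coordSum ψ x) ≤ fromℕ d
avg-coordSum²-≤ {n} ψ ∑ψ≡0 ψ²≤1 v d = begin
  avg X (λ x → coordSum ψ x * coordSum ψ x)                 ≡⟨ avg≡sumQ*avgWeight X _ ⟩
  sumQ X (λ x → coordSum ψ x * coordSum ψ x) * avgWeight X  ≤⟨ *-monoʳ-≤-nonNeg (avgWeight X) {{nonNegative (avgWeight-nonNeg X)}} (sumQ-coordSum²-≤ ψ ∑ψ≡0 ψ²≤1 d) ⟩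
  (fromℕ d * sumQ X (λ _ → 1ℚ)) * avgWeight X               ≡⟨ *-assoc (fromℕ d) _ _ ⟩
  fromℕ d * (sumQ X (λ _ → 1ℚ) * avgWeight X)               ≡⟨ cong (fromℕ d *_) (trans (sym (avg≡sumQ*avgWeight X _)) (avg-allVecs-const v d 1ℚ)) ⟩
  fromℕ d * 1ℚ                                              ≡⟨ *-identityʳ (fromℕ d) ⟩
  fromℕ d                                                   ∎
  where
  open ≤-Reasoning
  X = allVecs n d

module _ {n : ℕ} where

  -- The change of mass at v when every u with u < σ u is moved to σ u, for τ the inverse of σ.
  netInflow : (σ τ : Fin n → Fin n) → Fin n → ℚ
  netInflow σ τ v = 𝟙 (toℕ (τ v) <ᵇ toℕ v) - 𝟙 (toℕ v <ᵇ toℕ (σ v))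

  -1≤netInflow : ∀ σ τ v → - 1ℚ ≤ netInflow σ τ v
  -1≤netInflow σ τ v = 𝟙-difference-≥ (toℕ (τ v) <ᵇ toℕ v) (toℕ v <ᵇ toℕ (σ v))

  netInflow≤1 : ∀ σ τ v → netInflow σ τ v ≤ 1ℚ
  netInflow≤1 σ τ v = 𝟙-difference-≤ (toℕ (τ v) <ᵇ toℕ v) (toℕ v <ᵇ toℕ (σ v))

  moveUp : ∀ {d} → (Fin n → Fin n) → Fin d → Vec (Fin n) d → Vec (Fin n) d
  moveUp σ r x = if toℕ (lookup x r) <ᵇ toℕ (σ (lookup x r)) then x [ r ]≔ σ (lookup x r) else x

  module _ (π : Permutation′ n) where

    sumQ-netInflow : sumQ (allFin n) (netInflow (π ⟨$⟩ʳ_) (π ⟨$⟩ˡ_)) ≡ 0ℚ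
    sumQ-netInflow = begin
      sumQ L (netInflow (π ⟨$⟩ʳ_) (π ⟨$⟩ˡ_))                    ≡⟨ sumQ-- L _ _ ⟩
      sumQ L inflow - sumQ L (λ v → 𝟙 (toℕ v <ᵇ toℕ (π ⟨$⟩ʳ v))) ≡⟨ cong (λ o → sumQ L inflow - o) outflow≡inflow ⟩
      sumQ L inflow - sumQ L inflow                            ≡⟨ +-inverseʳ (sumQ L inflow) ⟩
      0ℚ                                                       ∎
      where
      open ≡-Reasoning
      L = allFin n
      inflow : Fin n → ℚ
      inflow v = 𝟙 (toℕ (π ⟨$⟩ˡ v) <ᵇ toℕ v)
      outflow≡inflow : sumQ L (λ v → 𝟙 (toℕ v <ᵇ toℕ (π ⟨$⟩ʳ v))) ≡ sumQ L inflow
      outflow≡inflow = trans (sumQ-cong L (λ v → cong (λ u → 𝟙 (toℕ u <ᵇ toℕ (π ⟨$⟩ʳ v))) (sym (inverseˡ π))))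
                             (sumQ-allFin-permute π inflow)

    sumQ-moveUp : ∀ {d} (r : Fin d) (F : Vec (Fin n) d → ℚ) →
      sumQ (allVecs n d) (λ x → F (moveUp (π ⟨$⟩ʳ_) r x) - F x) ≡
      sumQ (allVecs n d) (λ x → F x * netInflow (π ⟨$⟩ʳ_) (π ⟨$⟩ˡ_) (lookup x r))
    sumQ-moveUp {d} r F = begin
      sumQ X (λ x → F (moveUp (π ⟨$⟩ʳ_) r x) - F x)                 ≡⟨ sumQ-cong X (λ x → if-gain (moves x) (raise x) x) ⟩
      sumQ X (λ x → 𝟙 (moves x) * F (raise x) - 𝟙 (moves x) * F x) ≡⟨ sumQ-- X _ _ ⟩
      sumQ X (λ x → 𝟙 (moves x) * F (raise x)) - Out                ≡⟨ cong (_- Out) (sumQ-cong X arrivals) ⟩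
      sumQ X (λ x → In (raise x)) - Out                             ≡⟨ cong (_- Out) (sumQ-allVecs-permute-coordinate π r In) ⟩
      sumQ X In - Out                                               ≡⟨ sumQ-- X _ _ ⟨
      sumQ X (λ x → In x - 𝟙 (moves x) * F x)
        ≡⟨ sumQ-cong X (λ x → solve 3 (λ i o f → i :* f :- o :* f := f :* (i :- o)) refl (𝟙 (arrived x)) (𝟙 (moves x)) (F x)) ⟩
      sumQ X (λ x → F x * netInflow (π ⟨$⟩ʳ_) (π ⟨$⟩ˡ_) (lookup x r)) ∎
      where
      open ≡-Reasoning
      X = allVecs n d
      raise : Vec (Fin n) d → Vec (Fin n) d
      raise x = x [ r ]≔ (π ⟨$⟩ʳ lookup x r)
      moves : Vec (Fin n) d → Bool
      moves x = toℕ (lookup x r) <ᵇ toℕ (π ⟨$⟩ʳ lookup x r)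
      arrived : Vec (Fin n) d → Bool
      arrived z = toℕ (π ⟨$⟩ˡ lookup z r) <ᵇ toℕ (lookup z r)
      In : Vec (Fin n) d → ℚ
      In z = 𝟙 (arrived z) * F z
      Out = sumQ X (λ x → 𝟙 (moves x) * F x)
      if-gain : ∀ b y x → F (if b then y else x) - F x ≡ 𝟙 b * F y - 𝟙 b * F x
      if-gain true  y x = solve 2 (λ y x → y :- x := con 1ℚ :* y :- con 1ℚ :* x) refl (F y) (F x)
      if-gain false y x = solve 2 (λ y x → x :- x := con 0ℚ :* y :- con 0ℚ :* x) refl (F y) (F x)
      arrivals : ∀ x → 𝟙 (moves x) * F (raise x) ≡ In (raise x)
      arrivals x rewrite Vecₚ.lookup∘update r x (π ⟨$⟩ʳ lookup x r) | inverseˡ π {lookup x r} = refl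

module _ {n : ℕ} .{{_ : NonZero n}} where

  [m%n+o]%n≡[m+o]%n : ∀ m o → (m % n ℕ.+ o) % n ≡ (m ℕ.+ o) % n
  [m%n+o]%n≡[m+o]%n m o = begin
    (m % n ℕ.+ o) % n             ≡⟨ %-distribˡ-+ (m % n) o n ⟩
    (m % n % n ℕ.+ o % n) % n     ≡⟨ cong (λ r → (r ℕ.+ o % n) % n) (m%n%n≡m%n m n) ⟩
    (m % n ℕ.+ o % n) % n         ≡⟨ %-distribˡ-+ m o n ⟨
    (m ℕ.+ o) % n                 ∎
    where open ≡-Reasoning

  rotate : ℕ → Fin n → Fin n
  rotate a v = (toℕ v ℕ.+ a) mod n

  rotate-inverse : ∀ a b → n ∣ a ℕ.+ b → ∀ v → rotate b (rotate a v) ≡ v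
  rotate-inverse a b n∣a+b v = toℕ-injective (begin
    toℕ (rotate b (rotate a v))          ≡⟨ toℕ-fromℕ< _ ⟩
    (toℕ (rotate a v) ℕ.+ b) % n         ≡⟨ cong (λ u → (u ℕ.+ b) % n) (toℕ-fromℕ< _) ⟩
    ((toℕ v ℕ.+ a) % n ℕ.+ b) % n        ≡⟨ [m%n+o]%n≡[m+o]%n (toℕ v ℕ.+ a) b ⟩
    (toℕ v ℕ.+ a ℕ.+ b) % n              ≡⟨ cong (_% n) (ℕₚ.+-assoc (toℕ v) a b) ⟩
    (toℕ v ℕ.+ (a ℕ.+ b)) % n            ≡⟨ %-remove-+ʳ (toℕ v) n∣a+b ⟩
    toℕ v % n                            ≡⟨ m<n⇒m%n≡m (toℕ<n v) ⟩
    toℕ v                                ∎)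
    where open ≡-Reasoning

  n∣a+[n∸a%n] : ∀ a → n ∣ a ℕ.+ (n ∸ a % n)
  n∣a+[n∸a%n] a = m%n≡0⇒n∣m _ n (begin
    (a ℕ.+ (n ∸ a % n)) % n          ≡⟨ [m%n+o]%n≡[m+o]%n a (n ∸ a % n) ⟨
    (a % n ℕ.+ (n ∸ a % n)) % n      ≡⟨ cong (_% n) (ℕₚ.m+[n∸m]≡n (m%n≤n a n)) ⟩
    n % n                            ≡⟨ n%n≡0 n ⟩
    0                                ∎)
    where open ≡-Reasoning

  rotation : ℕ → Permutation′ n
  rotation a = permutation (rotate a) (rotate (n ∸ a % n))
    (rotate-inverse (n ∸ a % n) a (subst (n ∣_) (ℕₚ.+-comm a (n ∸ a % n)) (n∣a+[n∸a%n] a)))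
    (rotate-inverse a (n ∸ a % n) (n∣a+[n∸a%n] a))

module _ (k : ℕ) where

  instance
    N-nonZero : NonZero (N k)
    N-nonZero = ℕₚ.m^n≢0 2 (suc k)

  intervalExponents : List ℕ
  intervalExponents = applyUpTo suc (suc k)

  offsets : ℕ → ℕ → List ℕ
  offsets q j = filterᵇ (λ t → not (t ≡ᵇ j)) (upTo (2 ^ q))

  avgChoice : (ℕ → ℕ → ℕ → ℚ) → ℚ
  avgChoice g = avg intervalExponents λ q → avg (upTo (2 ^ q)) λ j → avg (offsets q j) λ t → g q j t

  start≤N : ∀ {q j} → q ∈ intervalExponents → j ∈ upTo (2 ^ q) → j ℕ.≤ N k
  start≤N q∈ j∈ with ∈-applyUpTo⁻ suc q∈
  ... | i , i<1+k , refl = ℕₚ.≤-trans (ℕₚ.<⇒≤ (∈-upTo⁻ j∈)) (ℕₚ.^-monoʳ-≤ 2 i<1+k)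

  avgChoice-cong-≤N : {g h : ℕ → ℕ → ℕ → ℚ} → (∀ q j t → j ℕ.≤ N k → g q j t ≡ h q j t) → avgChoice g ≡ avgChoice h
  avgChoice-cong-≤N e = avg-cong-∈ intervalExponents λ q q∈ → avg-cong-∈ (upTo (2 ^ q)) λ j j∈ →
    avg-cong (offsets q j) λ t → e q j t (start≤N q∈ j∈)

  avgChoice-linear : (c : ℚ) (g h : ℕ → ℕ → ℕ → ℚ) →
    avgChoice (λ q j t → c * g q j t + h q j t) ≡ c * avgChoice g + avgChoice h
  avgChoice-linear c g h =
    trans (avg-cong intervalExponents λ q →
             trans (avg-cong (upTo (2 ^ q)) λ j → avg-linear (offsets q j) c (g q j) (h q j))
                   (avg-linear (upTo (2 ^ q)) c _ _))
          (avg-linear intervalExponents c _ _)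

  avgChoice-*ˡ : (c : ℚ) (g : ℕ → ℕ → ℕ → ℚ) → avgChoice (λ q j t → c * g q j t) ≡ c * avgChoice g
  avgChoice-*ˡ c g =
    trans (avg-cong intervalExponents λ q →
             trans (avg-cong (upTo (2 ^ q)) λ j → avg-*ˡ (offsets q j) c (g q j))
                   (avg-*ˡ (upTo (2 ^ q)) c _))
          (avg-*ˡ intervalExponents c _)

  avgChoice-zero : avgChoice (λ _ _ _ → 0ℚ) ≡ 0ℚ
  avgChoice-zero =
    trans (avg-cong intervalExponents λ q →
             trans (avg-cong (upTo (2 ^ q)) λ j → avg-zero (offsets q j))
                   (avg-zero (upTo (2 ^ q))))
          (avg-zero intervalExponents)

  avg-avgChoice-comm : ∀ {A : Set} (l : List A) (g : A → ℕ → ℕ → ℕ → ℚ) →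
    avg l (λ a → avgChoice (g a)) ≡ avgChoice (λ q j t → avg l (λ a → g a q j t))
  avg-avgChoice-comm l g =
    trans (avg-comm l intervalExponents _) (avg-cong intervalExponents λ q →
      trans (avg-comm l (upTo (2 ^ q)) _) (avg-cong (upTo (2 ^ q)) λ j → avg-comm l (offsets q j) _))

  sumQ-avgChoice-comm : ∀ {A : Set} (l : List A) (g : A → ℕ → ℕ → ℕ → ℚ) →
    sumQ l (λ a → avgChoice (g a)) ≡ avgChoice (λ q j t → sumQ l (λ a → g a q j t))
  sumQ-avgChoice-comm l g =
    trans (sym (avg-sumQ-comm intervalExponents l _)) (avg-cong intervalExponents λ q →
      trans (sym (avg-sumQ-comm (upTo (2 ^ q)) l _)) (avg-cong (upTo (2 ^ q)) λ j → sym (avg-sumQ-comm (offsets q j) l _)))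

  avgChoice-≤ : {g : ℕ → ℕ → ℕ → ℚ} (c : ℚ) → 0ℚ ≤ c → (∀ q j t → g q j t ≤ c) → avgChoice g ≤ c
  avgChoice-≤ c 0≤c g≤c =
    avg-≤ intervalExponents c 0≤c λ q → avg-≤ (upTo (2 ^ q)) c 0≤c λ j → avg-≤ (offsets q j) c 0≤c λ t → g≤c q j t

  avgChoice-≥ : {g : ℕ → ℕ → ℕ → ℚ} (c : ℚ) → c ≤ 0ℚ → (∀ q j t → c ≤ g q j t) → c ≤ avgChoice g
  avgChoice-≥ c c≤0 c≤g =
    avg-≥ intervalExponents c c≤0 λ q → avg-≥ (upTo (2 ^ q)) c c≤0 λ j → avg-≥ (offsets q j) c c≤0 λ t → c≤g q j t

  shift : ℕ → ℕ → Fin (N k) → Fin (N k)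
  shift j t v = modN k ((toℕ v ℕ.+ N k ∸ j) ℕ.+ t)

  unshift : ℕ → ℕ → Fin (N k) → Fin (N k)
  unshift j t = rotate (N k ∸ (N k ∸ j ℕ.+ t) % N k)

  shift≗rotate : ∀ {j} t → j ℕ.≤ N k → ∀ v → shift j t v ≡ rotate (N k ∸ j ℕ.+ t) v
  shift≗rotate {j} t j≤N v = cong (_mod N k)
    (trans (cong (ℕ._+ t) (ℕₚ.+-∸-assoc (toℕ v) j≤N)) (ℕₚ.+-assoc (toℕ v) (N k ∸ j) t))

  shiftPermutation : ∀ {j} t → j ℕ.≤ N k → Permutation′ (N k)
  shiftPermutation {j} t j≤N = permutation (shift j t) (unshift j t)
    (λ v → trans (shift≗rotate t j≤N (unshift j t v)) (inverseʳ ρ))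
    (λ v → trans (cong (unshift j t) (shift≗rotate t j≤N v)) (inverseˡ ρ))
    where ρ = rotation {N k} (N k ∸ j ℕ.+ t)

  meanInflow : Fin (N k) → ℚ
  meanInflow v = avgChoice λ q j t → netInflow (shift j t) (unshift j t) v

  sumQ-meanInflow : sumQ (allFin (N k)) meanInflow ≡ 0ℚ
  sumQ-meanInflow = begin
    sumQ (allFin (N k)) meanInflow                                                   ≡⟨ sumQ-avgChoice-comm (allFin (N k)) _ ⟩
    avgChoice (λ q j t → sumQ (allFin (N k)) (netInflow (shift j t) (unshift j t)))  ≡⟨ avgChoice-cong-≤N (λ q j t j≤N → sumQ-netInflow (shiftPermutation t j≤N)) ⟩
    avgChoice (λ _ _ _ → 0ℚ)                                                         ≡⟨ avgChoice-zero ⟩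
    0ℚ                                                                               ∎
    where open ≡-Reasoning

  meanInflow²≤1 : ∀ v → meanInflow v * meanInflow v ≤ 1ℚ
  meanInflow²≤1 v = square-≤-1 (meanInflow v)
    (avgChoice-≥ (- 1ℚ) (≤ᵇ⇒≤ tt) (λ q j t → -1≤netInflow (shift j t) (unshift j t) v))
    (avgChoice-≤ 1ℚ (≤ᵇ⇒≤ tt) (λ q j t → netInflow≤1 (shift j t) (unshift j t) v))

module _ (k d : ℕ) (f : Vec (Fin (N k)) d → Bool) where

  private
    X : List (Vec (Fin (N k)) d)
    X = allVecs (N k) d
    F : Vec (Fin (N k)) d → ℚ
    F x = 𝟙 (f x)

  -- moveUp (shift k j t) r is the step of U₁ in probU1, so probU1 unfolds definitionally.
  drift : Vec (Fin (N k)) d → ℚ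
  drift x = avg (allFin d) λ r → avgChoice k λ q j t → F (moveUp (shift k j t) r x) - F x

  Itilde≡2Itilde⁻+drift : Itilde k d f ≡ fromℕ 2 * Itilde⁻ k d f + avg X (λ x → fromℕ d * drift x)
  Itilde≡2Itilde⁻+drift = trans (avg-cong X pointwise) (avg-linear X (fromℕ 2) _ _)
    where
    probU1-neqB : ∀ x → probU1 k d neqB f x ≡ fromℕ 2 * probU1 k d gtB f x + drift x
    probU1-neqB x = begin
      probU1 k d neqB f x                                                         ≡⟨ avg-cong R (λ r → avgChoice-cong-≤N k (λ q j t _ → 𝟙-neqB (f x) (f (y r j t)))) ⟩
      avg R (λ r → avgChoice k λ q j t → fromℕ 2 * gt r j t + (F (y r j t) - F x))
        ≡⟨ avg-cong R (λ r → avgChoice-linear k (fromℕ 2) (λ q j t → gt r j t) (λ q j t → F (y r j t) - F x)) ⟩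
      avg R (λ r → fromℕ 2 * avgChoice k (λ q j t → gt r j t) + Δ r)               ≡⟨ avg-linear R (fromℕ 2) (λ r → avgChoice k (λ q j t → gt r j t)) Δ ⟩
      fromℕ 2 * probU1 k d gtB f x + drift x                                      ∎
      where
      open ≡-Reasoning
      R = allFin d
      y : Fin d → ℕ → ℕ → Vec (Fin (N k)) d
      y r j t = moveUp (shift k j t) r x
      gt : Fin d → ℕ → ℕ → ℚ
      gt r j t = 𝟙 (gtB (f x) (f (y r j t)))
      Δ : Fin d → ℚ
      Δ r = avgChoice k λ q j t → F (y r j t) - F x
    pointwise : ∀ x → fromℕ d * probU1 k d neqB f x ≡ fromℕ 2 * (fromℕ d * probU1 k d gtB f x) + fromℕ d * drift x
    pointwise x = trans (cong (fromℕ d *_) (probU1-neqB x))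
      (solve 4 (λ c d p q → d :* (c :* p :+ q) := c :* (d :* p) :+ d :* q) refl (fromℕ 2) (fromℕ d) (probU1 k d gtB f x) (drift x))

  avg-drift-coordinate : ∀ r → avg X (λ x → avgChoice k λ q j t → F (moveUp (shift k j t) r x) - F x) ≡
                               avg X (λ x → F x * meanInflow k (lookup x r))
  avg-drift-coordinate r = begin
    avg X (λ x → avgChoice k λ q j t → F (moveUp (shift k j t) r x) - F x)                  ≡⟨ avg-avgChoice-comm k X _ ⟩
    avgChoice k (λ q j t → avg X λ x → F (moveUp (shift k j t) r x) - F x)
      ≡⟨ avgChoice-cong-≤N k (λ q j t j≤N → avg-cong-sumQ X (sumQ-moveUp (shiftPermutation k t j≤N) r F)) ⟩
    avgChoice k (λ q j t → avg X λ x → F x * netInflow (shift k j t) (unshift k j t) (lookup x r)) ≡⟨ avg-avgChoice-comm k X _ ⟨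
    avg X (λ x → avgChoice k λ q j t → F x * netInflow (shift k j t) (unshift k j t) (lookup x r)) ≡⟨ avg-cong X (λ x → avgChoice-*ˡ k (F x) _) ⟩
    avg X (λ x → F x * meanInflow k (lookup x r))                                            ∎
    where open ≡-Reasoning

  avg-drift : avg X (λ x → fromℕ d * drift x) ≡ avg X (λ x → F x * coordSum (meanInflow k) x)
  avg-drift = begin
    avg X (λ x → fromℕ d * drift x)                                  ≡⟨ avg-cong X (λ x → cong (_* drift x) (cong fromℕ (Listₚ.length-tabulate {n = d} (λ r → r)))) ⟨
    avg X (λ x → fromℕ (length R) * drift x)                         ≡⟨ avg-cong X (λ x → length*avg≡sumQ R _) ⟩
    avg X (λ x → sumQ R λ r → avgChoice k λ q j t → F (moveUp (shift k j t) r x) - F x) ≡⟨ avg-sumQ-comm X R _ ⟩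
    sumQ R (λ r → avg X λ x → avgChoice k λ q j t → F (moveUp (shift k j t) r x) - F x) ≡⟨ sumQ-cong R avg-drift-coordinate ⟩
    sumQ R (λ r → avg X λ x → F x * meanInflow k (lookup x r))       ≡⟨ avg-sumQ-comm X R _ ⟨
    avg X (λ x → sumQ R λ r → F x * meanInflow k (lookup x r))       ≡⟨ avg-cong X (λ x → sumQ-*ˡ R (F x) _) ⟩
    avg X (λ x → F x * sumQ R λ r → meanInflow k (lookup x r))       ≡⟨ avg-cong X (λ x → cong (F x *_) (sumQ-allFin-lookup≡coordSum (meanInflow k) x)) ⟩
    avg X (λ x → F x * coordSum (meanInflow k) x)                    ∎
    where
    open ≡-Reasoning
    R = allFin d

  avg-drift²-≤ : avg X (λ x → fromℕ d * drift x) * avg X (λ x → fromℕ d * drift x) ≤ fromℕ d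
  avg-drift²-≤ = subst (λ A → A * A ≤ fromℕ d) (sym avg-drift) (≤-trans
    (avg-indicator*-square-≤ X F (coordSum (meanInflow k)) (avg-allVecs-const origin d) F∈01)
    (avg-coordSum²-≤ (meanInflow k) (sumQ-meanInflow k) (meanInflow²≤1 k) origin d))
    where
    origin : Fin (N k)
    origin = _mod_ 0 (N k) {{N-nonZero k}}
    F∈01 : ∀ x → F x ≡ 0ℚ ⊎ F x ≡ 1ℚ
    F∈01 x with f x
    ... | true  = inj₂ refl
    ... | false = inj₁ refl

  Itilde⁻-nonNeg : 0ℚ ≤ Itilde⁻ k d f
  Itilde⁻-nonNeg = avg-≥ X 0ℚ ≤-refl λ x → *-nonNeg (fromℕ-nonNeg d)
    (avg-≥ (allFin d) 0ℚ ≤-refl λ r → avgChoice-≥ k 0ℚ ≤-refl λ q j t → 𝟙-nonNeg (gtB (f x) (f (moveUp (shift k j t) r x))))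

mainTheorem13 : (k d : ℕ) (f : Vec (Fin (N k)) d → Bool) →
    Itilde k d f > 9 √ d → Itilde⁻ k d f > 1 √ d
mainTheorem13 k d f (_ , 81d<Ĩ²) = Itilde⁻-nonNeg k d f ,
  subst (λ m → fromℕ m < Ĩ⁻ * Ĩ⁻) (sym (ℕₚ.*-identityˡ d))
    (81d<[2a+b]²⇒d<a² Ĩ⁻ D d (avg-drift²-≤ k d f)
      (subst (λ I → fromℕ (81 ℕ.* d) < I * I) (Itilde≡2Itilde⁻+drift k d f) 81d<Ĩ²))
  where
  Ĩ⁻ = Itilde⁻ k d f
  D = avg (allVecs (N k) d) (λ x → fromℕ d * drift k d f x)
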